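{- Let $p$ be a prime and $d\geq 1$. Then $\omega_1(p^{d+1})-\omega_1(p^d)\in\{0,p\}$.
   Context: An integer polynomial $f$ is a null polynomial modulo $m$ if $f(x)\equiv 0\pmod m$ for all integers $x$; a monic null polynomial of degree $n$ modulo $m$ is one coefficientwise congruent modulo $m$ to a monic polynomial of degree $n$. $\omega_1(m)$ is the least integer $n\geq 1$ for which a monic null polynomial of degree $n$ modulo $m$ exists. -}

module Defs where

open import Data.Nat using (ℕ; zero; suc; _≤_; _<_)
open import Data.Integer using (ℤ; +_; _+_; _*_; _-_)
open import Data.Integer.Divisibility using (_∣_)
open import Data.List using (List; []; _∷_; length; last)
open import Data.Unit using (⊤)
open import Data.Maybe using (Maybe; just)
open import Data.Product using (Σ; _×_; ∃)
open import Relation.Nullary using (¬_)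
open import Relation.Binary.PropositionalEquality using (_≡_)

-- Integer polynomials as coefficient lists, constant term first:
-- a₀ ∷ a₁ ∷ … ∷ aₖ ∷ []  represents  a₀ + a₁ x + … + aₖ xᵏ.
Poly : Set
Poly = List ℤ

eval : Poly → ℤ → ℤ
eval []       x = + 0
eval (a ∷ as) x = a + x * eval as x

IsNull : ℕ → Poly → Set
IsNull m f = ∀ (x : ℤ) → (+ m) ∣ eval f x

-- coefficientwise congruence modulo m (missing coefficients are 0)
CoeffCong : ℕ → Poly → Poly → Set
CoeffCong m []       []       = ⊤
CoeffCong m []       (b ∷ bs) = (+ m) ∣ (+ 0 - b) × CoeffCong m [] bs
CoeffCong m (a ∷ as) []       = (+ m) ∣ (a - + 0) × CoeffCong m as []
CoeffCong m (a ∷ as) (b ∷ bs) = (+ m) ∣ (a - b) × CoeffCong m as bs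

IsMonicOfDegree : ℕ → Poly → Set
IsMonicOfDegree n g = (length g ≡ suc n) × (last g ≡ just (+ 1))

IsMonicNullOfDegree : ℕ → ℕ → Poly → Set
IsMonicNullOfDegree m n f =
  IsNull m f × Σ Poly (λ g → IsMonicOfDegree n g × CoeffCong m f g)

-- n = ω₁(m): the least n ≥ 1 admitting a monic null polynomial of degree n mod m
IsOmega1 : ℕ → ℕ → Set
IsOmega1 m n =
  (1 ≤ n)
  × ∃ (λ f → IsMonicNullOfDegree m n f)
  × (∀ k → 1 ≤ k → k < n → ¬ ∃ (λ f → IsMonicNullOfDegree m k f))

module Submission where

-- ω₁(m) is Kempner's function S(m), the least n ≥ 1 with m ∣ n!. The n-th finite difference of a
-- monic polynomial of degree n is the constant n!, and it is divisible by m when the polynomial is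
-- null mod m; conversely the falling factorial x(x−1)⋯(x−n+1) is monic of degree n and all its
-- values are divisible by n!. Now let a = S(pᵈ) with d ≥ 1. Then p ∣ a, for otherwise pᵈ would
-- already divide (a−1)!. Since p ∣ a + p, the factorial (a+p)! is divisible by p^(d+1), whereas
-- (a+j)! for 0 < j < p has no more factors p than a! has.

open import Data.Nat using (ℕ; zero; suc; _≤_; _<_; _^_; _!; s≤s; z≤n; NonZero)
import Data.Nat.Properties as ℕ
open import Data.Nat.Divisibility
  using (_∣_; divides; _∣?_; ∣-trans; ∣-refl; ∣1⇒≡1; ∣⇒≤; ∣m∣n⇒∣m+n; ∣m+n∣m⇒∣n; n∣m*n; m∣m*n;
         *-pres-∣; *-monoʳ-∣; *-cancelˡ-∣; m≤n⇒m!∣n!; 1∣_)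
open import Data.Nat.Primality using (Prime; euclidsLemma; prime⇒nonZero; ¬prime[1])
open import Data.Product using (_×_; _,_; ∃; proj₁; proj₂)
open import Data.Sum using (_⊎_; inj₁; inj₂)
open import Relation.Nullary using (¬_; yes; no; contradiction)
open import Relation.Nullary.Decidable using (decidable-stable)
open import Relation.Binary.PropositionalEquality

open import Defs

IsKempner : ℕ → ℕ → Set
IsKempner m n = 1 ≤ n × m ∣ n ! × (∀ k → 1 ≤ k → k < n → ¬ m ∣ k !)

module NullPolynomial where

  open import Data.Integer as ℤ using (ℤ; +_; -[1+_]; 0ℤ; 1ℤ; _+_; _*_; _-_; -_)
  import Data.Integer.Properties as ℤ
  import Data.Integer.Divisibility.Signed as ℤ∣
  open ℤ∣ using () renaming (_∣_ to _∣ℤ_)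
  open import Data.Integer.Tactic.RingSolver using (solve-∀)
  open import Data.List using ([]; _∷_; length; last)
  open import Data.Maybe using (just)
  open import Data.Unit using (tt)
  open ≡-Reasoning

  -- The step is written 1ℤ + x rather than x + 1ℤ because 1ℤ + + n reduces to + suc n.
  Δ : ℕ → (ℤ → ℤ) → ℤ → ℤ
  Δ zero    f x = f x
  Δ (suc j) f x = Δ j f (1ℤ + x) - Δ j f x

  Δ-+const : ∀ j c (f : ℤ → ℤ) x → Δ (suc j) (λ y → c + f y) x ≡ Δ (suc j) f x
  Δ-+const zero    c f x = cancel c (f (1ℤ + x)) (f x)
    where
    cancel : ∀ c u v → (c + u) - (c + v) ≡ u - v
    cancel = solve-∀
  Δ-+const (suc j) c f x = cong₂ _-_ (Δ-+const j c f (1ℤ + x)) (Δ-+const j c f x)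

  Δ-leibniz : ∀ j (h : ℤ → ℤ) x →
    Δ (suc j) (λ y → y * h y) x ≡ x * Δ (suc j) h x + + suc j * Δ j h (1ℤ + x)
  Δ-leibniz zero    h x = base x (h (1ℤ + x)) (h x)
    where
    base : ∀ x u v → (1ℤ + x) * u - x * v ≡ x * (u - v) + 1ℤ * u
    base = solve-∀
  Δ-leibniz (suc j) h x = begin
    Δ (suc j) (λ y → y * h y) (1ℤ + x) - Δ (suc j) (λ y → y * h y) x
      ≡⟨ cong₂ _-_ (Δ-leibniz j h (1ℤ + x)) (Δ-leibniz j h x) ⟩
    ((1ℤ + x) * (u₂ - u₁) + k * u₂) - (x * v + k * u₁)
      ≡⟨ regroup x k v u₁ u₂ ⟩
    x * ((u₂ - u₁) - v) + (1ℤ + k) * (u₂ - u₁) ∎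
    where
    k  = + suc j
    v  = Δ (suc j) h x
    u₁ = Δ j h (1ℤ + x)
    u₂ = Δ j h (1ℤ + (1ℤ + x))
    regroup : ∀ x k v u₁ u₂ →
      ((1ℤ + x) * (u₂ - u₁) + k * u₂) - (x * v + k * u₁) ≡ x * ((u₂ - u₁) - v) + (1ℤ + k) * (u₂ - u₁)
    regroup = solve-∀

  Δ-degree : ∀ n (g : Poly) c → length g ≡ suc n → last g ≡ just c →
    (∀ x → Δ n (eval g) x ≡ + (n !) * c) × (∀ x → Δ (suc n) (eval g) x ≡ 0ℤ)
  Δ-degree zero (a ∷ []) c refl refl = constant a , vanishes a
    where
    constant : ∀ a x → a + x * 0ℤ ≡ 1ℤ * a
    constant = solve-∀
    vanishes : ∀ a x → (a + (1ℤ + x) * 0ℤ) - (a + x * 0ℤ) ≡ 0ℤ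
    vanishes = solve-∀
  Δ-degree (suc n) (a ∷ b ∷ bs) c len lst = top , vanishes
    where
    h = eval (b ∷ bs)
    IH = Δ-degree n (b ∷ bs) c (ℕ.suc-injective len) lst
    top : ∀ x → Δ (suc n) (eval (a ∷ b ∷ bs)) x ≡ + (suc n !) * c
    top x = begin
      Δ (suc n) (λ y → a + y * h y) x                 ≡⟨ Δ-+const n a _ x ⟩
      Δ (suc n) (λ y → y * h y) x                     ≡⟨ Δ-leibniz n h x ⟩
      x * Δ (suc n) h x + + suc n * Δ n h (1ℤ + x)
        ≡⟨ cong₂ (λ u v → x * u + + suc n * v) (proj₂ IH x) (proj₁ IH (1ℤ + x)) ⟩
      x * 0ℤ + + suc n * (+ (n !) * c)                ≡⟨ collect x (+ suc n) (+ (n !)) c ⟩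
      (+ suc n * + (n !)) * c                         ≡⟨ cong (_* c) (ℤ.pos-* (suc n) (n !)) ⟨
      + (suc n !) * c                                 ∎
      where
      collect : ∀ x k m c → x * 0ℤ + k * (m * c) ≡ (k * m) * c
      collect = solve-∀
    vanishes : ∀ x → Δ (suc (suc n)) (eval (a ∷ b ∷ bs)) x ≡ 0ℤ
    vanishes x = begin
      Δ (suc (suc n)) (λ y → a + y * h y) x            ≡⟨ Δ-+const (suc n) a _ x ⟩
      Δ (suc (suc n)) (λ y → y * h y) x                ≡⟨ Δ-leibniz (suc n) h x ⟩
      x * (Δ (suc n) h (1ℤ + x) - Δ (suc n) h x) + + suc (suc n) * Δ (suc n) h (1ℤ + x)
        ≡⟨ cong₂ (λ u v → x * (u - v) + + suc (suc n) * u) (proj₂ IH (1ℤ + x)) (proj₂ IH x) ⟩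
      x * (0ℤ - 0ℤ) + + suc (suc n) * 0ℤ               ≡⟨ annihilate x (+ suc (suc n)) ⟩
      0ℤ                                               ∎
      where
      annihilate : ∀ x k → x * (0ℤ - 0ℤ) + k * 0ℤ ≡ 0ℤ
      annihilate = solve-∀

  Δ-pres-∣ : ∀ {k} (f : ℤ → ℤ) → (∀ x → k ∣ℤ f x) → ∀ j x → k ∣ℤ Δ j f x
  Δ-pres-∣ f k∣f zero    x = k∣f x
  Δ-pres-∣ f k∣f (suc j) x = ℤ∣.∣m∣n⇒∣m-n (Δ-pres-∣ f k∣f j (1ℤ + x)) (Δ-pres-∣ f k∣f j x)

  CoeffCong⇒∣eval-eval : ∀ m f g → CoeffCong m f g → ∀ x → + m ∣ℤ eval f x - eval g x
  CoeffCong⇒∣eval-eval m []       []       _          x = ℤ∣.divides 0ℤ refl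
  CoeffCong⇒∣eval-eval m []       (b ∷ bs) (m∣b , cc) x =
    subst (+ m ∣ℤ_) (split b x (eval bs x))
      (ℤ∣.∣m∣n⇒∣m+n (ℤ∣.∣ᵤ⇒∣ {i = 0ℤ - b} m∣b) (ℤ∣.∣n⇒∣m*n x (CoeffCong⇒∣eval-eval m [] bs cc x)))
    where
    split : ∀ b x v → (0ℤ - b) + x * (0ℤ - v) ≡ 0ℤ - (b + x * v)
    split = solve-∀
  CoeffCong⇒∣eval-eval m (a ∷ as) []       (m∣a , cc) x =
    subst (+ m ∣ℤ_) (split a x (eval as x))
      (ℤ∣.∣m∣n⇒∣m+n (ℤ∣.∣ᵤ⇒∣ {i = a - 0ℤ} m∣a) (ℤ∣.∣n⇒∣m*n x (CoeffCong⇒∣eval-eval m as [] cc x)))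
    where
    split : ∀ a x u → (a - 0ℤ) + x * (u - 0ℤ) ≡ (a + x * u) - 0ℤ
    split = solve-∀
  CoeffCong⇒∣eval-eval m (a ∷ as) (b ∷ bs) (m∣a-b , cc) x =
    subst (+ m ∣ℤ_) (split a b x (eval as x) (eval bs x))
      (ℤ∣.∣m∣n⇒∣m+n (ℤ∣.∣ᵤ⇒∣ {i = a - b} m∣a-b) (ℤ∣.∣n⇒∣m*n x (CoeffCong⇒∣eval-eval m as bs cc x)))
    where
    split : ∀ a b x u v → (a - b) + x * (u - v) ≡ (a + x * u) - (b + x * v)
    split = solve-∀

  null-resp-CoeffCong : ∀ {m f g} → CoeffCong m f g → IsNull m f → ∀ x → + m ∣ℤ eval g x
  null-resp-CoeffCong {m} {f} {g} cc f-null x =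
    subst (+ m ∣ℤ_) (cancel (eval f x) (eval g x))
      (ℤ∣.∣m∣n⇒∣m-n (ℤ∣.∣ᵤ⇒∣ {i = eval f x} (f-null x)) (CoeffCong⇒∣eval-eval m f g cc x))
    where
    cancel : ∀ u v → u - (u - v) ≡ v
    cancel = solve-∀

  monicNull⇒∣! : ∀ {m n f} → IsMonicNullOfDegree m n f → m ∣ n !
  monicNull⇒∣! {m} {n} (f-null , g , (len , lst) , cc) =
    subst (λ z → m ∣ ℤ.∣ z ∣) Δⁿg≡n! (ℤ∣.∣⇒∣ᵤ (Δ-pres-∣ (eval g) (null-resp-CoeffCong cc f-null) n 0ℤ))
    where
    Δⁿg≡n! : Δ n (eval g) 0ℤ ≡ + (n !)
    Δⁿg≡n! = trans (proj₁ (Δ-degree n g 1ℤ len lst) 0ℤ) (ℤ.*-identityʳ (+ (n !)))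

  addToConstant : ℤ → Poly → Poly
  addToConstant a []       = a ∷ []
  addToConstant a (b ∷ bs) = a + b ∷ bs

  mulByLinear : ℤ → Poly → Poly
  mulByLinear c []       = []
  mulByLinear c (a ∷ as) = c * a ∷ addToConstant a (mulByLinear c as)

  eval-addToConstant : ∀ a g x → eval (addToConstant a g) x ≡ a + eval g x
  eval-addToConstant a []       x = cong (λ u → a + u) (ℤ.*-zeroʳ x)
  eval-addToConstant a (b ∷ bs) x = ℤ.+-assoc a b (x * eval bs x)

  eval-mulByLinear : ∀ c g x → eval (mulByLinear c g) x ≡ (x + c) * eval g x
  eval-mulByLinear c []       x = sym (ℤ.*-zeroʳ (x + c))
  eval-mulByLinear c (a ∷ as) x = begin
    c * a + x * eval (addToConstant a (mulByLinear c as)) x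
      ≡⟨ cong (λ u → c * a + x * u) (eval-addToConstant a (mulByLinear c as) x) ⟩
    c * a + x * (a + eval (mulByLinear c as) x)
      ≡⟨ cong (λ u → c * a + x * (a + u)) (eval-mulByLinear c as x) ⟩
    c * a + x * (a + (x + c) * eval as x)
      ≡⟨ factor x c a (eval as x) ⟩
    (x + c) * (a + x * eval as x) ∎
    where
    factor : ∀ x c a u → c * a + x * (a + (x + c) * u) ≡ (x + c) * (a + x * u)
    factor = solve-∀

  monic-∷ : ∀ {n} a g → IsMonicOfDegree n g → IsMonicOfDegree (suc n) (a ∷ g)
  monic-∷ a (b ∷ bs) (len , lst) = cong suc len , lst

  monic-addToConstant : ∀ {n} a g → IsMonicOfDegree (suc n) g → IsMonicOfDegree (suc n) (addToConstant a g)
  monic-addToConstant a (b ∷ c ∷ cs) monic = monic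

  monic-mulByLinear : ∀ {n} c g → IsMonicOfDegree n g → IsMonicOfDegree (suc n) (mulByLinear c g)
  monic-mulByLinear {zero}  c (b ∷ [])     (refl , lst) = refl , lst
  monic-mulByLinear {suc n} c (a ∷ b ∷ bs) (len , lst)  =
    monic-∷ (c * a) (addToConstant a cg) (monic-addToConstant a cg monic-cg)
    where
    cg = mulByLinear c (b ∷ bs)
    monic-cg = monic-mulByLinear c (b ∷ bs) (ℕ.suc-injective len , lst)

  fallingFactorial : ℕ → Poly
  fallingFactorial zero    = 1ℤ ∷ []
  fallingFactorial (suc n) = mulByLinear (- + n) (fallingFactorial n)

  monic-fallingFactorial : ∀ n → IsMonicOfDegree n (fallingFactorial n)
  monic-fallingFactorial zero    = refl , refl
  monic-fallingFactorial (suc n) = monic-mulByLinear (- + n) (fallingFactorial n) (monic-fallingFactorial n)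

  eval-fallingFactorial-suc : ∀ n x → eval (fallingFactorial (suc n)) x ≡ (x - + n) * eval (fallingFactorial n) x
  eval-fallingFactorial-suc n = eval-mulByLinear (- + n) (fallingFactorial n)

  fallingFactorial-shift : ∀ n x →
    eval (fallingFactorial (suc n)) (1ℤ + x) ≡ (1ℤ + x) * eval (fallingFactorial n) x
  fallingFactorial-shift zero x = begin
    eval (fallingFactorial 1) (1ℤ + x)   ≡⟨ eval-fallingFactorial-suc 0 (1ℤ + x) ⟩
    (1ℤ + x - 0ℤ) * (1ℤ + (1ℤ + x) * 0ℤ) ≡⟨ normalise x ⟩
    (1ℤ + x) * (1ℤ + x * 0ℤ)             ∎
    where
    normalise : ∀ x → (1ℤ + x - 0ℤ) * (1ℤ + (1ℤ + x) * 0ℤ) ≡ (1ℤ + x) * (1ℤ + x * 0ℤ)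
    normalise = solve-∀
  fallingFactorial-shift (suc n) x = begin
    eval (fallingFactorial (suc (suc n))) (1ℤ + x)      ≡⟨ eval-fallingFactorial-suc (suc n) (1ℤ + x) ⟩
    (1ℤ + x - (1ℤ + + n)) * eval (fallingFactorial (suc n)) (1ℤ + x)
      ≡⟨ cong ((1ℤ + x - (1ℤ + + n)) *_) (fallingFactorial-shift n x) ⟩
    (1ℤ + x - (1ℤ + + n)) * ((1ℤ + x) * F)              ≡⟨ regroup x (+ n) F ⟩
    (1ℤ + x) * ((x - + n) * F)                          ≡⟨ cong ((1ℤ + x) *_) (eval-fallingFactorial-suc n x) ⟨
    (1ℤ + x) * eval (fallingFactorial (suc n)) x        ∎
    where
    F = eval (fallingFactorial n) x
    regroup : ∀ x k F → (1ℤ + x - (1ℤ + k)) * ((1ℤ + x) * F) ≡ (1ℤ + x) * ((x - k) * F)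
    regroup = solve-∀

  Δ-fallingFactorial : ∀ n x → Δ 1 (eval (fallingFactorial (suc n))) x ≡ + suc n * eval (fallingFactorial n) x
  Δ-fallingFactorial n x = begin
    eval (fallingFactorial (suc n)) (1ℤ + x) - eval (fallingFactorial (suc n)) x
      ≡⟨ cong₂ _-_ (fallingFactorial-shift n x) (eval-fallingFactorial-suc n x) ⟩
    (1ℤ + x) * F - (x - + n) * F  ≡⟨ difference x (+ n) F ⟩
    (1ℤ + + n) * F               ∎
    where
    F = eval (fallingFactorial n) x
    difference : ∀ x k F → (1ℤ + x) * F - (x - k) * F ≡ (1ℤ + k) * F
    difference = solve-∀

  fallingFactorial-root : ∀ n → eval (fallingFactorial (suc n)) 0ℤ ≡ 0ℤ
  fallingFactorial-root zero    = refl
  fallingFactorial-root (suc n) = begin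
    eval (fallingFactorial (suc (suc n))) 0ℤ                    ≡⟨ eval-fallingFactorial-suc (suc n) 0ℤ ⟩
    (0ℤ - + suc n) * eval (fallingFactorial (suc n)) 0ℤ        ≡⟨ cong ((0ℤ - + suc n) *_) (fallingFactorial-root n) ⟩
    (0ℤ - + suc n) * 0ℤ                                        ≡⟨ ℤ.*-zeroʳ (0ℤ - + suc n) ⟩
    0ℤ                                                         ∎

  ∣-from-Δ : ∀ {k} (f : ℤ → ℤ) → k ∣ℤ f 0ℤ → (∀ x → k ∣ℤ Δ 1 f x) → ∀ x → k ∣ℤ f x
  ∣-from-Δ {k} f k∣f0 k∣Δf = go
    where
    up : ∀ x → k ∣ℤ f x → k ∣ℤ f (1ℤ + x)
    up x k∣fx = ℤ∣.∣m+n∣n⇒∣m (k∣Δf x) (ℤ∣.∣m⇒∣-m k∣fx)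
    down : ∀ x → k ∣ℤ f (1ℤ + x) → k ∣ℤ f x
    down x k∣fx+1 = subst (k ∣ℤ_) (ℤ.neg-involutive (f x)) (ℤ∣.∣m⇒∣-m (ℤ∣.∣m+n∣m⇒∣n (k∣Δf x) k∣fx+1))
    go : ∀ x → k ∣ℤ f x
    go (+ zero)        = k∣f0
    go (+ suc n)       = up (+ n) (go (+ n))
    go -[1+ zero ]     = down -[1+ zero ] k∣f0
    go -[1+ suc n ]    = down -[1+ suc n ] (go -[1+ n ])

  n!∣fallingFactorial : ∀ n x → + (n !) ∣ℤ eval (fallingFactorial n) x
  n!∣fallingFactorial zero    x = ℤ∣.divides (eval (fallingFactorial 0) x) (sym (ℤ.*-identityʳ _))
  n!∣fallingFactorial (suc n) = ∣-from-Δ (eval (fallingFactorial (suc n))) root step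
    where
    root : + (suc n !) ∣ℤ eval (fallingFactorial (suc n)) 0ℤ
    root = subst (+ (suc n !) ∣ℤ_) (sym (fallingFactorial-root n)) (ℤ∣.divides 0ℤ refl)
    step : ∀ x → + (suc n !) ∣ℤ Δ 1 (eval (fallingFactorial (suc n))) x
    step x = subst₂ _∣ℤ_ (sym (ℤ.pos-* (suc n) (n !))) (sym (Δ-fallingFactorial n x))
               (ℤ∣.*-monoʳ-∣ (+ suc n) (n!∣fallingFactorial n x))

  CoeffCong-refl : ∀ m f → CoeffCong m f f
  CoeffCong-refl m []       = tt
  CoeffCong-refl m (a ∷ as) = ℤ∣.∣⇒∣ᵤ {+ m} {a - a} (ℤ∣.divides 0ℤ (ℤ.+-inverseʳ a)) , CoeffCong-refl m as

  ∣!⇒monicNull : ∀ {m n} → m ∣ n ! → ∃ (IsMonicNullOfDegree m n)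
  ∣!⇒monicNull {m} {n} m∣n! =
    fallingFactorial n , null , fallingFactorial n , monic-fallingFactorial n , CoeffCong-refl m (fallingFactorial n)
    where
    null : IsNull m (fallingFactorial n)
    null x = ℤ∣.∣⇒∣ᵤ {+ m} (ℤ∣.∣-trans (ℤ∣.∣ᵤ⇒∣ {+ m} {+ (n !)} m∣n!) (n!∣fallingFactorial n x))

  isOmega1⇒isKempner : ∀ {m n} → IsOmega1 m n → IsKempner m n
  isOmega1⇒isKempner (1≤n , (_ , monicNull) , minimal) =
    1≤n , monicNull⇒∣! monicNull , λ k 1≤k k<n m∣k! → minimal k 1≤k k<n (∣!⇒monicNull m∣k!)

open NullPolynomial using (isOmega1⇒isKempner)
open import Data.Nat using (_+_; _*_; pred)

kempner-minimal : ∀ {m n k} → IsKempner m n → 1 ≤ k → m ∣ k ! → n ≤ k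
kempner-minimal (_ , _ , minimal) 1≤k m∣k! = ℕ.≮⇒≥ (λ k<n → minimal _ 1≤k k<n m∣k!)

kempner-mono : ∀ {m m′ n n′} → IsKempner m n → IsKempner m′ n′ → m ∣ m′ → n ≤ n′
kempner-mono kn (1≤n′ , m′∣n′! , _) m∣m′ = kempner-minimal kn 1≤n′ (∣-trans m∣m′ m′∣n′!)

p^e≢1 : ∀ {p e} → Prime p → 1 ≤ e → p ^ e ≢ 1
p^e≢1 {p} {suc e} pr _ p^[1+e]≡1 = ¬prime[1] (subst Prime (ℕ.m*n≡1⇒m≡1 p (p ^ e) p^[1+e]≡1) pr)

p^e∣c*n⇒p^e∣n : ∀ {p c} → Prime p → ¬ p ∣ c → ∀ e n → p ^ e ∣ c * n → p ^ e ∣ n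
p^e∣c*n⇒p^e∣n pr p∤c zero    n _ = 1∣ n
p^e∣c*n⇒p^e∣n {p} {c} pr p∤c (suc e) n p^[1+e]∣cn
  with euclidsLemma c n pr (∣-trans (m∣m*n (p ^ e)) p^[1+e]∣cn)
... | inj₁ p∣c              = contradiction p∣c p∤c
... | inj₂ (divides q refl) =
  subst (p * p ^ e ∣_) (ℕ.*-comm p q) (*-monoʳ-∣ p (p^e∣c*n⇒p^e∣n pr p∤c e q p^e∣cq))
  where
  c[qp]≡p[cq] : c * (q * p) ≡ p * (c * q)
  c[qp]≡p[cq] = trans (sym (ℕ.*-assoc c q p)) (ℕ.*-comm (c * q) p)
  p^e∣cq : p ^ e ∣ c * q
  p^e∣cq = *-cancelˡ-∣ p {{prime⇒nonZero pr}} (subst (p * p ^ e ∣_) c[qp]≡p[cq] p^[1+e]∣cn)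

p^e∣n!⇒p^e∣a! : ∀ {p a n} e → Prime p → p ∣ a → a ≤ n → n < a + p → p ^ e ∣ n ! → p ^ e ∣ a !
p^e∣n!⇒p^e∣a! {p} {a} e pr p∣a a≤n n<a+p with ℕ.m≤n⇒∃[o]m+o≡n a≤n
... | j , refl = skip j (ℕ.+-cancelˡ-< a j p n<a+p)
  where
  skip : ∀ j → j < p → p ^ e ∣ (a + j) ! → p ^ e ∣ a !
  skip zero    _     = subst (λ m → p ^ e ∣ m !) (ℕ.+-identityʳ a)
  skip (suc j) 1+j<p p^e∣[a+1+j]! =
    skip j (ℕ.<⇒≤ 1+j<p)
      (p^e∣c*n⇒p^e∣n pr p∤1+a+j e ((a + j) !) (subst (λ m → p ^ e ∣ m !) (ℕ.+-suc a j) p^e∣[a+1+j]!))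
    where
    p∤1+a+j : ¬ p ∣ suc (a + j)
    p∤1+a+j p∣ = ℕ.<⇒≱ 1+j<p (∣⇒≤ (∣m+n∣m⇒∣n (subst (p ∣_) (sym (ℕ.+-suc a j)) p∣) p∣a))

p^[1+d]∣[a+p]! : ∀ {p a} d .{{_ : NonZero p}} → p ∣ a → p ^ d ∣ a ! → p ^ suc d ∣ (a + p) !
p^[1+d]∣[a+p]! {p} {a} d p∣a p^d∣a! =
  subst (λ m → p ^ suc d ∣ m !) (sym a+p≡1+a+q)
    (*-pres-∣ p∣1+a+q (∣-trans p^d∣a! (m≤n⇒m!∣n! (ℕ.m≤m+n a q))))
  where
  q = pred p
  a+p≡1+a+q : a + p ≡ suc (a + q)
  a+p≡1+a+q = trans (cong (a +_) (sym (ℕ.suc-pred p))) (ℕ.+-suc a q)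
  p∣1+a+q : p ∣ suc (a + q)
  p∣1+a+q = subst (p ∣_) a+p≡1+a+q (∣m∣n⇒∣m+n p∣a ∣-refl)

p∣kempner[p^d] : ∀ {p d a} → Prime p → 1 ≤ d → IsKempner (p ^ d) a → p ∣ a
p∣kempner[p^d] {p} {d} {a} pr 1≤d ka = decidable-stable (p ∣? a) (¬p∤kempner ka)
  where
  ¬p∤kempner : ∀ {a} → IsKempner (p ^ d) a → ¬ ¬ p ∣ a
  ¬p∤kempner {suc zero}    (_ , p^d∣1 , _)        _   = p^e≢1 pr 1≤d (∣1⇒≡1 p^d∣1)
  ¬p∤kempner {suc (suc a)} (_ , p^d∣a! , minimal) p∤a =
    minimal (suc a) (s≤s z≤n) (ℕ.n<1+n _) (p^e∣c*n⇒p^e∣n pr p∤a d (suc a !) p^d∣a!)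

kempner[p^[1+d]] : ∀ {p d a b} → Prime p → 1 ≤ d → IsKempner (p ^ d) a → IsKempner (p ^ suc d) b →
  b ≡ a ⊎ b ≡ a + p
kempner[p^[1+d]] {p} {d} {a} {b} pr 1≤d ka@(1≤a , p^d∣a! , _) kb@(_ , p^[1+d]∣b! , _)
  with p ^ suc d ∣? a !
... | yes p^[1+d]∣a! = inj₁ (ℕ.≤-antisym (kempner-minimal kb 1≤a p^[1+d]∣a!) (kempner-mono ka kb (n∣m*n p)))
... | no  p^[1+d]∤a! = inj₂ (ℕ.≤-antisym b≤a+p a+p≤b)
  where
  a≤b : a ≤ b
  a≤b = kempner-mono ka kb (n∣m*n p)
  p∣a : p ∣ a
  p∣a = p∣kempner[p^d] pr 1≤d ka
  b≤a+p : b ≤ a + p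
  b≤a+p = kempner-minimal kb (ℕ.≤-trans 1≤a (ℕ.m≤m+n a p))
    (p^[1+d]∣[a+p]! d {{prime⇒nonZero pr}} p∣a p^d∣a!)
  a+p≤b : a + p ≤ b
  a+p≤b = ℕ.≮⇒≥ λ b<a+p → p^[1+d]∤a! (p^e∣n!⇒p^e∣a! (suc d) pr p∣a a≤b b<a+p p^[1+d]∣b!)

mainTheorem7 : (p d a b : ℕ) → Prime p → 1 ≤ d →
    IsOmega1 (p ^ d) a → IsOmega1 (p ^ suc d) b →
    (b ≡ a) ⊎ (b ≡ a + p)
mainTheorem7 p d a b pr 1≤d ω₁[p^d]≡a ω₁[p^[1+d]]≡b =
  kempner[p^[1+d]] pr 1≤d (isOmega1⇒isKempner ω₁[p^d]≡a) (isOmega1⇒isKempner ω₁[p^[1+d]]≡b)
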